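{- For every $m\ge3$, $|\mathbf K_m(v)|$ has the form $$|\mathbf K_m(v)|=\frac{(1-v)^{m-2}+P_m(x,v)}{(1-v)^{m-2}},$$ where $P_m(x,v)$ is a polynomial in $x$ and $v$ that is not identically zero, satisfies $P_m(0,v)=0$, and is not divisible by $1-v$.
   Context: For $m\ge1$, $\mathbf K_m(v)$ is the $m\times m$ matrix with entries in $\mathbb{Q}(x,v)$ defined as follows. - All diagonal entries equal $1-xv$, except the $(m,m)$ entry, which equals $1-xv+\frac{xv}{1-v}$. - All entries strictly above the diagonal equal $-xv$. - The entries at positions $(i+1,i)$ equal $\frac{xv}{1-v}$. - All other entries are $0$. $|\cdot|$ denotes the determinant. -}

module Defs where

open import Data.Nat using (ℕ; zero; suc; _∸_; _≤_; _+_; _≡ᵇ_; _<ᵇ_)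
open import Data.Bool using (Bool; true; false; if_then_else_)
open import Data.Fin using (Fin; zero; suc; toℕ; punchIn)
open import Data.Rational using (ℚ; 0ℚ; 1ℚ) renaming (_+_ to _+ℚ_; _*_ to _*ℚ_; -_ to -ℚ_)
open import Data.Product using (∃)
open import Relation.Binary.PropositionalEquality using (_≡_)

-- Bivariate coefficient arrays over ℚ.  s i j is the coefficient of x^i v^j.
-- (A priori formal power series; 'IsPolynomial' singles out polynomials.)

Series : Set
Series = ℕ → ℕ → ℚ

sumTo : ℕ → (ℕ → ℚ) → ℚ
sumTo zero    f = f 0
sumTo (suc n) f = sumTo n f +ℚ f (suc n)

𝟘 𝟙 X V : Series
𝟘 i j = 0ℚ
𝟙 zero zero = 1ℚ
𝟙 _    _    = 0ℚ
X (suc zero) zero = 1ℚ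
X _          _    = 0ℚ
V zero (suc zero) = 1ℚ
V _    _          = 0ℚ

infixl 6 _⊕_ _⊖_
infixl 7 _⊗_

_⊕_ : Series → Series → Series
(p ⊕ q) i j = p i j +ℚ q i j

⊝_ : Series → Series
(⊝ p) i j = -ℚ (p i j)

_⊖_ : Series → Series → Series
p ⊖ q = p ⊕ (⊝ q)

_⊗_ : Series → Series → Series
(p ⊗ q) i j = sumTo i (λ a → sumTo j (λ b → p a b *ℚ q (i ∸ a) (j ∸ b)))

_^^_ : Series → ℕ → Series
p ^^ zero  = 𝟙
p ^^ suc n = p ⊗ (p ^^ n)

_≋_ : Series → Series → Set
p ≋ q = ∀ i j → p i j ≡ q i j

IsPolynomial : Series → Set
IsPolynomial p = ∃ λ N → ∀ i j → N ≤ i + j → p i j ≡ 0ℚ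

_∣ₚ_ : Series → Series → Set
d ∣ₚ p = ∃ λ q → IsPolynomial q Data.Product.× (p ≋ (d ⊗ q))

oneMinusV : Series
oneMinusV = 𝟙 ⊖ V

-- Elements of ℚ(x,v) as fractions num/den of polynomials,
-- with equality by cross-multiplication.

record Frac : Set where
  constructor _//_
  field
    num : Series
    den : Series
open Frac public

infix 4 _≈F_
_≈F_ : Frac → Frac → Set
a ≈F b = (num a ⊗ den b) ≋ (num b ⊗ den a)

infixl 6 _+F_
infixl 7 _*F_

_+F_ : Frac → Frac → Frac
a +F b = (num a ⊗ den b ⊕ num b ⊗ den a) // (den a ⊗ den b)

_*F_ : Frac → Frac → Frac
a *F b = (num a ⊗ num b) // (den a ⊗ den b)

-F_ : Frac → Frac
-F a = (⊝ num a) // den a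

0F 1F : Frac
0F = 𝟘 // 𝟙
1F = 𝟙 // 𝟙

poly : Series → Frac
poly p = p // 𝟙

sumFin : (n : ℕ) → (Fin n → Frac) → Frac
sumFin zero    f = 0F
sumFin (suc n) f = f zero +F sumFin n (λ j → f (suc j))

signF : ℕ → Frac → Frac
signF zero          a = a
signF (suc zero)    a = -F a
signF (suc (suc k)) a = signF k a

det : (n : ℕ) → (Fin n → Fin n → Frac) → Frac
det zero    A = 1F
det (suc n) A =
  sumFin (suc n) (λ j → signF (toℕ j)
    (A zero j *F det n (λ r c → A (suc r) (punchIn j c))))

xv : Series
xv = X ⊗ V

xvOver : Frac
xvOver = xv // oneMinusV

Kentry : ℕ → ℕ → ℕ → Frac
Kentry m i j =
  if i ≡ᵇ j then
    (if suc i ≡ᵇ m then poly (𝟙 ⊖ xv) +F xvOver else poly (𝟙 ⊖ xv))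
  else if i <ᵇ j then poly (⊝ xv)
  else if i ≡ᵇ suc j then xvOver
  else 0F

K : (m : ℕ) → Fin m → Fin m → Frac
K m i j = Kentry m (toℕ i) (toℕ j)

-- Expanding 1/(1 - v) as a geometric series turns K_m into a matrix of power series in x and v.
-- Writing a = xv, b = xv/(1 - v), d = 1 - xv, e = 1 - v, expansion along the first row gives
-- D (n+2) = d D (n+1) + a b W (n+1) and W (n+2) = D (n+1) - b W (n+1), where D n = |K_n| and W n is
-- |K_n| with its first row replaced by ones. Since b e = a, multiplying by e^(k+1) clears all
-- denominators: D (k+3) e^(k+1) = e^(k+1) + P k and W (k+3) e^(k+1) = Y k for polynomials P k, Y k
-- obeying a polynomial recurrence in which every term of P k carries a factor a, so P k (0, v) = 0.
-- At v = 1 we have e = 0 and a = x, and the recurrence collapses to P (k+1) = x² Y k, Y (k+1) = -x Y k;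
-- hence the coefficient of x^(k+3) in P k (x, 1) is ±1, so P k ≠ 0 and 1 - v does not divide P k.

module Submission where

open import Defs
open import Data.Nat as ℕ using (ℕ; zero; suc; _≤_; _∸_; z≤n; s≤s)
import Data.Nat.Properties as ℕₚ
open import Data.Rational using (ℚ; 0ℚ; 1ℚ) renaming (_+_ to _+ℚ_; _*_ to _*ℚ_; -_ to -ℚ_)
import Data.Rational.Properties as ℚₚ
open import Data.Fin using (Fin; zero; suc; toℕ; punchIn)
open import Data.Product using (Σ; ∃; _×_; _,_; proj₁; proj₂)
open import Data.Sum using (_⊎_; inj₁; inj₂)
open import Relation.Nullary using (¬_)
open import Relation.Binary.PropositionalEquality as ≡ using (_≡_; _≢_)
open import Algebra.Bundles using (CommutativeRing)
open import Algebra.Structures using (IsCommutativeRing)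
import Algebra.Construct.Pointwise as Pointwise

module PowerSeries {c ℓ} (R : CommutativeRing c ℓ) where

  open ℕₚ using ( ≤-refl; m≤n⇒m≤1+n; n∸n≡0; +-∸-assoc; +-suc; m+[n∸m]≡n; m∸[m∸n]≡n
                ; m+n∸m≡n; ∸-+-assoc)
  open CommutativeRing R
  open import Algebra.Properties.CommutativeSemigroup +-commutativeSemigroup using (interchange)
  open import Algebra.Properties.AbelianGroup +-abelianGroup using (⁻¹-∙-comm)
  open import Relation.Binary.Reasoning.Setoid setoid

  Seq : Set c
  Seq = ℕ → Carrier

  sum≤ : ℕ → Seq → Carrier
  sum≤ zero    f = f 0
  sum≤ (suc n) f = sum≤ n f + f (suc n)

  sum≤-cong≤ : ∀ n {f g : Seq} → (∀ i → i ≤ n → f i ≈ g i) → sum≤ n f ≈ sum≤ n g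
  sum≤-cong≤ zero    f≈g = f≈g 0 z≤n
  sum≤-cong≤ (suc n) f≈g =
    +-cong (sum≤-cong≤ n (λ i i≤n → f≈g i (m≤n⇒m≤1+n i≤n))) (f≈g (suc n) ≤-refl)

  sum≤-cong : ∀ n {f g : Seq} → (∀ i → f i ≈ g i) → sum≤ n f ≈ sum≤ n g
  sum≤-cong n f≈g = sum≤-cong≤ n (λ i _ → f≈g i)

  sum≤-zero : ∀ n (f : Seq) → (∀ i → f i ≈ 0#) → sum≤ n f ≈ 0#
  sum≤-zero zero    f f≈0 = f≈0 0
  sum≤-zero (suc n) f f≈0 = trans (+-cong (sum≤-zero n f f≈0) (f≈0 (suc n))) (+-identityˡ 0#)

  sum≤-distrib-+ : ∀ n (f g : Seq) → sum≤ n (λ i → f i + g i) ≈ sum≤ n f + sum≤ n g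
  sum≤-distrib-+ zero    f g = refl
  sum≤-distrib-+ (suc n) f g = trans (+-congʳ (sum≤-distrib-+ n f g)) (interchange _ _ _ _)

  -‿distrib-sum≤ : ∀ n (f : Seq) → - sum≤ n f ≈ sum≤ n (λ i → - f i)
  -‿distrib-sum≤ zero    f = refl
  -‿distrib-sum≤ (suc n) f = trans (sym (⁻¹-∙-comm _ _)) (+-congʳ (-‿distrib-sum≤ n f))

  *-distribˡ-sum≤ : ∀ n a (f : Seq) → a * sum≤ n f ≈ sum≤ n (λ i → a * f i)
  *-distribˡ-sum≤ zero    a f = refl
  *-distribˡ-sum≤ (suc n) a f = trans (distribˡ _ _ _) (+-congʳ (*-distribˡ-sum≤ n a f))

  *-distribʳ-sum≤ : ∀ n a (f : Seq) → sum≤ n f * a ≈ sum≤ n (λ i → f i * a)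
  *-distribʳ-sum≤ zero    a f = refl
  *-distribʳ-sum≤ (suc n) a f = trans (distribʳ _ _ _) (+-congʳ (*-distribʳ-sum≤ n a f))

  sum≤-unfoldˡ : ∀ n (f : Seq) → sum≤ (suc n) f ≈ f 0 + sum≤ n (λ i → f (suc i))
  sum≤-unfoldˡ zero    f = refl
  sum≤-unfoldˡ (suc n) f = trans (+-congʳ (sum≤-unfoldˡ n f)) (+-assoc _ _ _)

  sum≤-reverse : ∀ n (f : Seq) → sum≤ n f ≈ sum≤ n (λ i → f (n ∸ i))
  sum≤-reverse zero    f = refl
  sum≤-reverse (suc n) f = sym (begin
    sum≤ (suc n) (λ i → f (suc n ∸ i))   ≈⟨ sum≤-unfoldˡ n _ ⟩
    f (suc n) + sum≤ n (λ i → f (n ∸ i))  ≈⟨ +-congˡ (sym (sum≤-reverse n f)) ⟩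
    f (suc n) + sum≤ n f                  ≈⟨ +-comm _ _ ⟩
    sum≤ n f + f (suc n)                  ∎)

  sum≤-triangle : ∀ n (F : ℕ → ℕ → Carrier) →
    sum≤ n (λ k → sum≤ k (λ i → F i k)) ≈ sum≤ n (λ i → sum≤ (n ∸ i) (λ j → F i (i ℕ.+ j)))
  sum≤-triangle zero    F = refl
  sum≤-triangle (suc n) F = sym (begin
    sum≤ n (λ i → sum≤ (suc n ∸ i) (row i)) + sum≤ (n ∸ n) (row (suc n))
      ≈⟨ +-cong (sum≤-cong≤ n rowExtends) lastRow ⟩
    sum≤ n (λ i → sum≤ (n ∸ i) (row i) + F i (suc n)) + F (suc n) (suc n)
      ≈⟨ +-congʳ (sum≤-distrib-+ n _ _) ⟩
    (sum≤ n (λ i → sum≤ (n ∸ i) (row i)) + sum≤ n (λ i → F i (suc n))) + F (suc n) (suc n)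
      ≈⟨ +-assoc _ _ _ ⟩
    sum≤ n (λ i → sum≤ (n ∸ i) (row i)) + sum≤ (suc n) (λ i → F i (suc n))
      ≈⟨ +-congʳ (sym (sum≤-triangle n F)) ⟩
    sum≤ n (λ k → sum≤ k (λ i → F i k)) + sum≤ (suc n) (λ i → F i (suc n)) ∎)
    where
    row : ℕ → Seq
    row i j = F i (i ℕ.+ j)
    lastRow : sum≤ (n ∸ n) (row (suc n)) ≈ F (suc n) (suc n)
    lastRow = reflexive (≡.trans (≡.cong (λ k → sum≤ k (row (suc n))) (n∸n≡0 n))
                                 (≡.cong (F (suc n)) (ℕₚ.+-identityʳ (suc n))))
    rowExtends : ∀ i → i ≤ n → sum≤ (suc n ∸ i) (row i) ≈ sum≤ (n ∸ i) (row i) + F i (suc n)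
    rowExtends i i≤n = trans (reflexive (≡.cong (λ k → sum≤ k (row i)) (+-∸-assoc 1 i≤n)))
      (+-congˡ (reflexive (≡.cong (F i) (≡.trans (+-suc i (n ∸ i)) (≡.cong suc (m+[n∸m]≡n i≤n))))))

  _≈ₛ_ : Seq → Seq → Set ℓ
  f ≈ₛ g = ∀ i → f i ≈ g i

  _+ₛ_ : Seq → Seq → Seq
  (f +ₛ g) i = f i + g i

  -ₛ_ : Seq → Seq
  (-ₛ f) i = - f i

  0ₛ 1ₛ : Seq
  0ₛ _       = 0#
  1ₛ zero    = 1#
  1ₛ (suc _) = 0#

  _*ₛ_ : Seq → Seq → Seq
  (f *ₛ g) n = sum≤ n (λ i → f i * g (n ∸ i))

  *ₛ-cong : ∀ {f f′ g g′} → f ≈ₛ f′ → g ≈ₛ g′ → (f *ₛ g) ≈ₛ (f′ *ₛ g′)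
  *ₛ-cong f≈f′ g≈g′ n = sum≤-cong n (λ i → *-cong (f≈f′ i) (g≈g′ (n ∸ i)))

  *ₛ-comm : ∀ f g → (f *ₛ g) ≈ₛ (g *ₛ f)
  *ₛ-comm f g n = trans (sum≤-reverse n _) (sum≤-cong≤ n (λ i i≤n →
    trans (*-comm _ _) (*-congʳ (reflexive (≡.cong g (m∸[m∸n]≡n i≤n))))))

  *ₛ-identityˡ : ∀ f → (1ₛ *ₛ f) ≈ₛ f
  *ₛ-identityˡ f zero    = *-identityˡ (f 0)
  *ₛ-identityˡ f (suc n) = begin
    (1ₛ *ₛ f) (suc n)                             ≈⟨ sum≤-unfoldˡ n _ ⟩
    1# * f (suc n) + sum≤ n (λ i → 0# * f (n ∸ i))  ≈⟨ +-cong (*-identityˡ _) (sum≤-zero n _ (λ _ → zeroˡ _)) ⟩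
    f (suc n) + 0#                                 ≈⟨ +-identityʳ _ ⟩
    f (suc n)                                      ∎

  *ₛ-distribˡ : ∀ f g h → (f *ₛ (g +ₛ h)) ≈ₛ ((f *ₛ g) +ₛ (f *ₛ h))
  *ₛ-distribˡ f g h n = trans (sum≤-cong n (λ i → distribˡ _ _ _)) (sum≤-distrib-+ n _ _)

  *ₛ-assoc : ∀ f g h → ((f *ₛ g) *ₛ h) ≈ₛ (f *ₛ (g *ₛ h))
  *ₛ-assoc f g h n = begin
    sum≤ n (λ k → sum≤ k (λ i → f i * g (k ∸ i)) * h (n ∸ k))
      ≈⟨ sum≤-cong n (λ k → *-distribʳ-sum≤ k _ _) ⟩
    sum≤ n (λ k → sum≤ k (λ i → f i * g (k ∸ i) * h (n ∸ k)))
      ≈⟨ sum≤-triangle n (λ i k → f i * g (k ∸ i) * h (n ∸ k)) ⟩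
    sum≤ n (λ i → sum≤ (n ∸ i) (λ j → f i * g (i ℕ.+ j ∸ i) * h (n ∸ (i ℕ.+ j))))
      ≈⟨ sum≤-cong n (λ i → sum≤-cong (n ∸ i) (λ j → trans (*-assoc _ _ _)
           (*-congˡ (*-cong (reflexive (≡.cong g (m+n∸m≡n i j)))
                            (reflexive (≡.cong h (≡.sym (∸-+-assoc n i j)))))))) ⟩
    sum≤ n (λ i → sum≤ (n ∸ i) (λ j → f i * (g j * h (n ∸ i ∸ j))))
      ≈⟨ sum≤-cong n (λ i → sym (*-distribˡ-sum≤ (n ∸ i) _ _)) ⟩
    sum≤ n (λ i → f i * sum≤ (n ∸ i) (λ j → g j * h (n ∸ i ∸ j))) ∎

  isPowerSeriesRing : IsCommutativeRing _≈ₛ_ _+ₛ_ _*ₛ_ -ₛ_ 0ₛ 1ₛ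
  isPowerSeriesRing = record
    { isRing = record
      { +-isAbelianGroup = Pointwise.isAbelianGroup ℕ +-isAbelianGroup
      ; *-cong           = *ₛ-cong
      ; *-assoc          = *ₛ-assoc
      ; *-identity       = *ₛ-identityˡ , λ f n → trans (*ₛ-comm f 1ₛ n) (*ₛ-identityˡ f n)
      ; distrib          = *ₛ-distribˡ , λ f g h n → trans (*ₛ-comm (g +ₛ h) f n)
          (trans (*ₛ-distribˡ f g h n) (+-cong (*ₛ-comm f g n) (*ₛ-comm f h n)))
      }
    ; *-comm = *ₛ-comm
    }

  powerSeriesRing : CommutativeRing c ℓ
  powerSeriesRing = record { isCommutativeRing = isPowerSeriesRing }

  *ₛ-constantˡ : ∀ f g → (∀ i → f (suc i) ≈ 0#) → ∀ n → (f *ₛ g) n ≈ f 0 * g n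
  *ₛ-constantˡ f g f≈0 zero    = refl
  *ₛ-constantˡ f g f≈0 (suc n) = trans (sum≤-unfoldˡ n _)
    (trans (+-congˡ (sum≤-zero n _ (λ i → trans (*-congʳ (f≈0 i)) (zeroˡ _)))) (+-identityʳ _))

  *ₛ-shiftˡ : ∀ f g → f 0 ≈ 0# → ∀ n → (f *ₛ g) (suc n) ≈ ((λ i → f (suc i)) *ₛ g) n
  *ₛ-shiftˡ f g f0≈0 n =
    trans (sum≤-unfoldˡ n _) (trans (+-congʳ (trans (*-congʳ f0≈0) (zeroˡ _))) (+-identityˡ _))

module Determinant {c ℓ} (R : CommutativeRing c ℓ) where

  open CommutativeRing R hiding (zero)
  open import Algebra.Properties.Ring ring using (-‿distribʳ-*; -0#≈0#; -‿involutive)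
  open import Algebra.Properties.Semiring.Sum semiring using (sum; sum-cong-≋; sum-replicate-zero)

  Matrix : ℕ → Set c
  Matrix n = Fin n → Fin n → Carrier

  sign : ℕ → Carrier → Carrier
  sign zero          a = a
  sign (suc zero)    a = - a
  sign (suc (suc k)) a = sign k a

  minor : ∀ {n} → Matrix (suc n) → Fin (suc n) → Matrix n
  minor A j r c = A (suc r) (punchIn j c)

  determinant : (n : ℕ) → Matrix n → Carrier
  laplaceTerm : ∀ n → Matrix (suc n) → Fin (suc n) → Carrier

  determinant zero    A = 1#
  determinant (suc n) A = sum (laplaceTerm n A)

  laplaceTerm n A j = sign (toℕ j) (A zero j * determinant n (minor A j))

  sum-zero : ∀ n (f : Fin n → Carrier) → (∀ j → f j ≈ 0#) → sum f ≈ 0#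
  sum-zero n f f≈0 = trans (sum-cong-≋ f≈0) (sum-replicate-zero n)

  sign-cong : ∀ k {a b} → a ≈ b → sign k a ≈ sign k b
  sign-cong zero          a≈b = a≈b
  sign-cong (suc zero)    a≈b = -‿cong a≈b
  sign-cong (suc (suc k)) a≈b = sign-cong k a≈b

  sign-zero : ∀ k → sign k 0# ≈ 0#
  sign-zero zero          = refl
  sign-zero (suc zero)    = -0#≈0#
  sign-zero (suc (suc k)) = sign-zero k

  sign-suc : ∀ k a → sign (suc k) a ≈ - sign k a
  sign-suc zero          a = refl
  sign-suc (suc zero)    a = sym (-‿involutive a)
  sign-suc (suc (suc k)) a = sign-suc k a

  sign-*ˡ : ∀ k a b → sign k (a * b) ≈ a * sign k b
  sign-*ˡ zero          a b = refl
  sign-*ˡ (suc zero)    a b = -‿distribʳ-* a b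
  sign-*ˡ (suc (suc k)) a b = sign-*ˡ k a b

  sign-*-zero : ∀ k a {b} → b ≈ 0# → sign k (a * b) ≈ 0#
  sign-*-zero k a b≈0 = trans (sign-cong k (trans (*-congˡ b≈0) (zeroʳ a))) (sign-zero k)

  determinant-zeroColumn : ∀ n (A : Matrix (suc n)) → (∀ r → A r zero ≈ 0#) → determinant (suc n) A ≈ 0#
  determinant-zeroColumn zero    A col≈0 =
    sum-zero 1 (laplaceTerm 0 A) λ { zero → trans (*-congʳ (col≈0 zero)) (zeroˡ _) }
  determinant-zeroColumn (suc n) A col≈0 = sum-zero (suc (suc n)) (laplaceTerm (suc n) A) λ where
    zero    → trans (*-congʳ (col≈0 zero)) (zeroˡ _)
    (suc j) → sign-*-zero (toℕ (suc j)) _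
                (determinant-zeroColumn n (minor A (suc j)) (λ r → col≈0 (suc r)))

  determinant-expandFirstColumn : ∀ n (A : Matrix (suc n)) → (∀ r → A (suc r) zero ≈ 0#) →
    determinant (suc n) A ≈ A zero zero * determinant n (λ r c → A (suc r) (suc c))
  determinant-expandFirstColumn zero    A col≈0 = +-identityʳ _
  determinant-expandFirstColumn (suc n) A col≈0 =
    trans (+-congˡ (sum-zero (suc n) (λ j → laplaceTerm (suc n) A (suc j)) λ j →
      sign-*-zero (toℕ (suc j)) _ (determinant-zeroColumn n (minor A (suc j)) col≈0)))
    (+-identityʳ _)

module BivariateSeries where

  open import Data.Maybe using (Maybe; just; nothing)
  open import Relation.Nullary using (yes; no)
  open import Algebra.Solver.Ring.AlmostCommutativeRing
    using (fromCommutativeRing; _-Raw-AlmostCommutative⟶_)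
  import Algebra.Solver.Ring as RingSolver

  ℚ-ring : CommutativeRing _ _
  ℚ-ring = ℚₚ.+-*-commutativeRing

  module ℚ⟦v⟧ = PowerSeries ℚ-ring
  module ℚ⟦v⟧⟦x⟧ = PowerSeries ℚ⟦v⟧.powerSeriesRing

  sumTo-cong : ∀ n {f g : ℕ → ℚ} → (∀ i → f i ≡ g i) → sumTo n f ≡ sumTo n g
  sumTo-cong zero    f≡g = f≡g 0
  sumTo-cong (suc n) f≡g = ≡.cong₂ _+ℚ_ (sumTo-cong n f≡g) (f≡g (suc n))

  sum≤≡sumTo : ∀ n f → ℚ⟦v⟧.sum≤ n f ≡ sumTo n f
  sum≤≡sumTo zero    f = ≡.refl
  sum≤≡sumTo (suc n) f = ≡.cong (_+ℚ f (suc n)) (sum≤≡sumTo n f)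

  sum≤-apply : ∀ n F j → ℚ⟦v⟧⟦x⟧.sum≤ n F j ≡ sumTo n (λ i → F i j)
  sum≤-apply zero    F j = ≡.refl
  sum≤-apply (suc n) F j = ≡.cong (_+ℚ F (suc n) j) (sum≤-apply n F j)

  infixl 6 _+ₛ_
  infixl 7 _*ₛ_
  infix  8 -ₛ_

  -- Opaque: letting the ring solver below see the coefficient sums makes it several times slower.
  opaque
    _+ₛ_ _*ₛ_ : Series → Series → Series
    _+ₛ_ = ℚ⟦v⟧⟦x⟧._+ₛ_
    _*ₛ_ = ℚ⟦v⟧⟦x⟧._*ₛ_

    -ₛ_ : Series → Series
    -ₛ_ = ℚ⟦v⟧⟦x⟧.-ₛ_

    isCommutativeRingₛ : IsCommutativeRing _≋_ _+ₛ_ _*ₛ_ -ₛ_ ℚ⟦v⟧⟦x⟧.0ₛ ℚ⟦v⟧⟦x⟧.1ₛ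
    isCommutativeRingₛ = ℚ⟦v⟧⟦x⟧.isPowerSeriesRing

    ⊗≋*ₛ : ∀ p q → (p ⊗ q) ≋ (p *ₛ q)
    ⊗≋*ₛ p q i j = ≡.sym (≡.trans (sum≤-apply i _ j) (sumTo-cong i (λ _ → sum≤≡sumTo j _)))

    ⊕≋+ₛ : ∀ p q → (p ⊕ q) ≋ (p +ₛ q)
    ⊕≋+ₛ p q i j = ≡.refl

    ⊝≋-ₛ : ∀ p → (⊝ p) ≋ (-ₛ p)
    ⊝≋-ₛ p i j = ≡.refl

  ℚ⟦x,v⟧ : CommutativeRing _ _
  ℚ⟦x,v⟧ = record
    { Carrier = Series ; _≈_ = _≋_ ; _+_ = _+ₛ_ ; _*_ = _*ₛ_ ; -_ = -ₛ_
    ; 0# = ℚ⟦v⟧⟦x⟧.0ₛ ; 1# = ℚ⟦v⟧⟦x⟧.1ₛ ; isCommutativeRing = isCommutativeRingₛ }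

  +ₛ-apply : ∀ p q i j → (p +ₛ q) i j ≡ p i j +ℚ q i j
  +ₛ-apply p q i j = ≡.sym (⊕≋+ₛ p q i j)

  -ₛ-apply : ∀ p i j → (-ₛ p) i j ≡ -ℚ p i j
  -ₛ-apply p i j = ≡.sym (⊝≋-ₛ p i j)

  opaque
    unfolding _*ₛ_

    V*ₛ-zero : ∀ q i → (V *ₛ q) i 0 ≡ 0ℚ
    V*ₛ-zero q i = ≡.trans (ℚ⟦v⟧⟦x⟧.*ₛ-constantˡ V q (λ _ _ → ≡.refl) i 0) (ℚₚ.*-zeroˡ (q i 0))

    V*ₛ-suc : ∀ q i j → (V *ₛ q) i (suc j) ≡ q i j
    V*ₛ-suc q i j = ≡.trans (ℚ⟦v⟧⟦x⟧.*ₛ-constantˡ V q (λ _ _ → ≡.refl) i (suc j))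
      (≡.trans (ℚ⟦v⟧.*ₛ-shiftˡ (V 0) (q i) ≡.refl j)
      (≡.trans (ℚ⟦v⟧.*ₛ-constantˡ (λ k → V 0 (suc k)) (q i) (λ _ → ≡.refl) j) (ℚₚ.*-identityˡ _)))

    X*ₛ-zero : ∀ q j → (X *ₛ q) 0 j ≡ 0ℚ
    X*ₛ-zero q j = ℚ⟦v⟧.sum≤-zero j _ (λ b → ℚₚ.*-zeroˡ (q 0 (j ∸ b)))

    X*ₛ-suc : ∀ q i j → (X *ₛ q) (suc i) j ≡ q i j
    X*ₛ-suc q i j = ≡.trans (ℚ⟦v⟧⟦x⟧.*ₛ-shiftˡ X q (λ _ → ≡.refl) i j)
      (≡.trans (ℚ⟦v⟧⟦x⟧.*ₛ-constantˡ (λ k → X (suc k)) q (λ _ _ → ≡.refl) i j)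
      (≡.trans (ℚ⟦v⟧.*ₛ-constantˡ (X 1) (q i) (λ _ → ≡.refl) j) (ℚₚ.*-identityˡ _)))

  constant : ℚ → Series
  constant c zero    zero    = c
  constant c zero    (suc _) = 0ℚ
  constant c (suc _) _       = 0ℚ

  opaque
    unfolding _*ₛ_ _+ₛ_ -ₛ_

    constant-+ : ∀ c c′ → constant (c +ℚ c′) ≋ (constant c +ₛ constant c′)
    constant-+ c c′ zero    zero    = ≡.refl
    constant-+ c c′ zero    (suc j) = ≡.refl
    constant-+ c c′ (suc i) j       = ≡.refl

    constant-* : ∀ c c′ → constant (c *ℚ c′) ≋ (constant c *ₛ constant c′)
    constant-* c c′ i j = ≡.sym
      (≡.trans (ℚ⟦v⟧⟦x⟧.*ₛ-constantˡ (constant c) (constant c′) (λ _ _ → ≡.refl) i j)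
      (≡.trans (ℚ⟦v⟧.*ₛ-constantˡ (constant c 0) (constant c′ i) (λ _ → ≡.refl) j) (scale i j)))
      where
      scale : ∀ i j → c *ℚ constant c′ i j ≡ constant (c *ℚ c′) i j
      scale zero    zero    = ≡.refl
      scale zero    (suc j) = ℚₚ.*-zeroʳ c
      scale (suc i) j       = ℚₚ.*-zeroʳ c

    constant-neg : ∀ c → constant (-ℚ c) ≋ (-ₛ constant c)
    constant-neg c zero    zero    = ≡.refl
    constant-neg c zero    (suc j) = ≡.refl
    constant-neg c (suc i) j       = ≡.refl

  constant-0 : constant 0ℚ ≋ ℚ⟦v⟧⟦x⟧.0ₛ
  constant-0 zero    zero    = ≡.refl
  constant-0 zero    (suc j) = ≡.refl
  constant-0 (suc i) j       = ≡.refl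

  constant-1 : constant 1ℚ ≋ ℚ⟦v⟧⟦x⟧.1ₛ
  constant-1 zero    zero    = ≡.refl
  constant-1 zero    (suc j) = ≡.refl
  constant-1 (suc i) j       = ≡.refl

  constant-homomorphism : CommutativeRing.rawRing ℚ-ring -Raw-AlmostCommutative⟶ fromCommutativeRing ℚ⟦x,v⟧
  constant-homomorphism = record
    { ⟦_⟧    = constant
    ; +-homo = constant-+
    ; *-homo = constant-*
    ; -‿homo = constant-neg
    ; 0-homo = constant-0
    ; 1-homo = constant-1
    }

  constant-≟ : ∀ c c′ → Maybe (constant c ≋ constant c′)
  constant-≟ c c′ with c ℚₚ.≟ c′
  ... | yes ≡.refl = just (λ _ _ → ≡.refl)
  ... | no _       = nothing

  module Solver = RingSolver (CommutativeRing.rawRing ℚ-ring) (fromCommutativeRing ℚ⟦x,v⟧)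
                             constant-homomorphism constant-≟

module Entries where

  open BivariateSeries
  open CommutativeRing ℚ⟦x,v⟧ hiding (zero)
  open import Algebra.Properties.Ring ring using (-‿distribˡ-*)
  open import Relation.Binary.Reasoning.Setoid setoid

  -- The solver's constant 1, rather than 1#, so that d and e can be spelled out inside solver terms.
  one : Series
  one = constant 1ℚ

  -- b = xv/(1 - v); K_m has d on the diagonal (d + b in the corner), -a above it and b below it.
  a b d e geometricV : Series
  a = X * V
  e = one + - V
  d = one + - a
  b = a * geometricV
  geometricV zero    _ = 1ℚ
  geometricV (suc _) _ = 0ℚ

  𝟙≈one : 𝟙 ≈ one
  𝟙≈one zero    zero    = ≡.refl
  𝟙≈one zero    (suc j) = ≡.refl
  𝟙≈one (suc i) j       = ≡.refl

  one≈1# : one ≈ 1#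
  one≈1# = constant-1

  𝟙≈1# : 𝟙 ≈ 1#
  𝟙≈1# = trans 𝟙≈one one≈1#

  one-* : ∀ q → one * q ≈ q
  one-* q = trans (*-congʳ one≈1#) (*-identityˡ q)

  e*-expand : ∀ q → e * q ≈ q + - (V * q)
  e*-expand q = trans (distribʳ q one (- V)) (+-cong (one-* q) (sym (-‿distribˡ-* V q)))

  a*-expand : ∀ q → a * q ≈ X * (V * q)
  a*-expand q = *-assoc X V q

  d*-expand : ∀ q → d * q ≈ q + - (X * (V * q))
  d*-expand q = trans (distribʳ q one (- a))
    (+-cong (one-* q) (trans (sym (-‿distribˡ-* a q)) (-‿cong (a*-expand q))))

  geometricV-unfold : geometricV ≈ one + V * geometricV
  geometricV-unfold i j = ≡.sym (≡.trans (+ₛ-apply one (V * geometricV) i j) (step i j))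
    where
    step : ∀ i j → one i j +ℚ (V * geometricV) i j ≡ geometricV i j
    step zero    zero    = ≡.trans (≡.cong (1ℚ +ℚ_) (V*ₛ-zero geometricV 0)) (ℚₚ.+-identityʳ 1ℚ)
    step zero    (suc j) = ≡.trans (≡.cong (0ℚ +ℚ_) (V*ₛ-suc geometricV 0 j)) (ℚₚ.+-identityˡ 1ℚ)
    step (suc i) zero    = ≡.trans (≡.cong (0ℚ +ℚ_) (V*ₛ-zero geometricV (suc i))) (ℚₚ.+-identityʳ 0ℚ)
    step (suc i) (suc j) = ≡.trans (≡.cong (0ℚ +ℚ_) (V*ₛ-suc geometricV (suc i) j)) (ℚₚ.+-identityʳ 0ℚ)

  e*geometricV : e * geometricV ≈ one
  e*geometricV = begin
    e * geometricV                             ≈⟨ e*-expand geometricV ⟩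
    geometricV + - (V * geometricV)            ≈⟨ +-congʳ geometricV-unfold ⟩
    one + V * geometricV + - (V * geometricV)  ≈⟨ +-assoc _ _ _ ⟩
    one + (V * geometricV + - (V * geometricV)) ≈⟨ +-congˡ (-‿inverseʳ _) ⟩
    one + 0#                                   ≈⟨ +-identityʳ one ⟩
    one                                        ∎

  b*e : b * e ≈ a
  b*e = begin
    a * geometricV * e   ≈⟨ *-assoc a geometricV e ⟩
    a * (geometricV * e) ≈⟨ *-congˡ (trans (*-comm geometricV e) e*geometricV) ⟩
    a * one              ≈⟨ trans (*-comm a one) (one-* a) ⟩
    a                    ∎

  xv≈a : xv ≈ a
  xv≈a = ⊗≋*ₛ X V

  oneMinusV≈e : oneMinusV ≈ e
  oneMinusV≈e = trans (⊕≋+ₛ 𝟙 (⊝ V)) (+-cong 𝟙≈one (⊝≋-ₛ V))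

module SeriesExpansion where

  open import Data.Nat using (_≡ᵇ_; _<ᵇ_)
  open import Data.Bool using (true; false; if_then_else_)
  open BivariateSeries
  open Entries
  open CommutativeRing ℚ⟦x,v⟧ hiding (zero)
  open import Algebra.Properties.Ring ring using (-‿distribˡ-*)
  open import Algebra.Properties.Semiring.Sum semiring using (sum)
  open import Relation.Binary.Reasoning.Setoid setoid
  open Determinant ℚ⟦x,v⟧ using (Matrix; sign; determinant)

  _expandsTo_ : Frac → Series → Set
  f expandsTo s = num f ≈ s * den f

  +F-expandsTo : ∀ {f g s t} → f expandsTo s → g expandsTo t → (f +F g) expandsTo (s + t)
  +F-expandsTo {nf // df} {ng // dg} {s} {t} f↦s g↦t = begin
    nf ⊗ dg ⊕ ng ⊗ df             ≈⟨ ⊕≋+ₛ (nf ⊗ dg) (ng ⊗ df) ⟩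
    nf ⊗ dg + ng ⊗ df             ≈⟨ +-cong (⊗≋*ₛ nf dg) (⊗≋*ₛ ng df) ⟩
    nf * dg + ng * df             ≈⟨ +-cong (*-congʳ f↦s) (*-congʳ g↦t) ⟩
    s * df * dg + t * dg * df     ≈⟨ solve 4 (λ s t df dg → s :* df :* dg :+ t :* dg :* df
                                                          := (s :+ t) :* (df :* dg)) refl s t df dg ⟩
    (s + t) * (df * dg)           ≈⟨ *-congˡ (sym (⊗≋*ₛ df dg)) ⟩
    (s + t) * (df ⊗ dg)           ∎
    where open Solver

  *F-expandsTo : ∀ {f g s t} → f expandsTo s → g expandsTo t → (f *F g) expandsTo (s * t)
  *F-expandsTo {nf // df} {ng // dg} {s} {t} f↦s g↦t = begin
    nf ⊗ ng                ≈⟨ ⊗≋*ₛ nf ng ⟩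
    nf * ng                ≈⟨ *-cong f↦s g↦t ⟩
    s * df * (t * dg)      ≈⟨ solve 4 (λ s t df dg → s :* df :* (t :* dg) := s :* t :* (df :* dg))
                                refl s t df dg ⟩
    s * t * (df * dg)      ≈⟨ *-congˡ (sym (⊗≋*ₛ df dg)) ⟩
    s * t * (df ⊗ dg)      ∎
    where open Solver

  -F-expandsTo : ∀ {f s} → f expandsTo s → (-F f) expandsTo (- s)
  -F-expandsTo {nf // df} {s} f↦s = trans (⊝≋-ₛ nf) (trans (-‿cong f↦s) (-‿distribˡ-* s df))

  poly-expandsTo : ∀ {p s} → p ≈ s → poly p expandsTo s
  poly-expandsTo {p} {s} p≈s = trans p≈s (sym (trans (*-congˡ 𝟙≈1#) (*-identityʳ s)))

  sumFin-expandsTo : ∀ n (f : Fin n → Frac) (g : Fin n → Series) →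
    (∀ j → f j expandsTo g j) → sumFin n f expandsTo sum g
  sumFin-expandsTo zero    f g f↦g = poly-expandsTo refl
  sumFin-expandsTo (suc n) f g f↦g =
    +F-expandsTo (f↦g zero) (sumFin-expandsTo n (λ j → f (suc j)) (λ j → g (suc j)) (λ j → f↦g (suc j)))

  signF-expandsTo : ∀ k {f s} → f expandsTo s → signF k f expandsTo sign k s
  signF-expandsTo zero          f↦s = f↦s
  signF-expandsTo (suc zero)    f↦s = -F-expandsTo f↦s
  signF-expandsTo (suc (suc k)) f↦s = signF-expandsTo k f↦s

  det-expandsTo : ∀ n (A : Fin n → Fin n → Frac) (M : Matrix n) →
    (∀ r c → A r c expandsTo M r c) → det n A expandsTo determinant n M
  det-expandsTo zero    A M A↦M = poly-expandsTo 𝟙≈1#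
  det-expandsTo (suc n) A M A↦M = sumFin-expandsTo (suc n) _ _ (λ j → signF-expandsTo (toℕ j)
    (*F-expandsTo (A↦M zero j) (det-expandsTo n _ _ (λ r c → A↦M (suc r) (punchIn j c)))))

  Kentryₛ : ℕ → ℕ → ℕ → Series
  Kentryₛ m i j =
    if i ≡ᵇ j then (if suc i ≡ᵇ m then d + b else d)
    else if i <ᵇ j then - a
    else if i ≡ᵇ suc j then b
    else 0#

  Kₛ : (m : ℕ) → Matrix m
  Kₛ m i j = Kentryₛ m (toℕ i) (toℕ j)

  xvOver-expandsTo : xvOver expandsTo b
  xvOver-expandsTo = trans xv≈a (trans (sym b*e) (*-congˡ (sym oneMinusV≈e)))

  diagonal-expandsTo : poly (𝟙 ⊖ xv) expandsTo d
  diagonal-expandsTo =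
    poly-expandsTo (trans (⊕≋+ₛ 𝟙 (⊝ xv)) (+-cong 𝟙≈one (trans (⊝≋-ₛ xv) (-‿cong xv≈a))))

  Kentry-expandsTo : ∀ m i j → Kentry m i j expandsTo Kentryₛ m i j
  Kentry-expandsTo m i j with i ≡ᵇ j
  ... | true with suc i ≡ᵇ m
  ...   | true  = +F-expandsTo diagonal-expandsTo xvOver-expandsTo
  ...   | false = diagonal-expandsTo
  Kentry-expandsTo m i j | false with i <ᵇ j
  ... | true = poly-expandsTo (trans (⊝≋-ₛ xv) (-‿cong xv≈a))
  ... | false with i ≡ᵇ suc j
  ...   | true  = xvOver-expandsTo
  ...   | false = poly-expandsTo refl

  detK-expandsTo : ∀ m → det m (K m) expandsTo determinant m (Kₛ m)
  detK-expandsTo m = det-expandsTo m (K m) (Kₛ m) (λ r c → Kentry-expandsTo m (toℕ r) (toℕ c))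

module Recurrence where

  open BivariateSeries
  open Entries
  open SeriesExpansion using (Kₛ)
  open CommutativeRing ℚ⟦x,v⟧ hiding (zero)
  open import Algebra.Properties.Ring ring using (-‿distribˡ-*; -‿involutive)
  open import Algebra.Properties.Semiring.Sum semiring using (sum; sum-cong-≋; *-distribˡ-sum)
  open import Relation.Binary.Reasoning.Setoid setoid
  open Determinant ℚ⟦x,v⟧

  onesOnTop : ∀ {n} → Matrix n → Matrix n
  onesOnTop A zero    c = 1#
  onesOnTop A (suc r) c = A (suc r) c

  D W : ℕ → Series
  D n = determinant n (Kₛ n)
  W n = determinant n (onesOnTop (Kₛ n))

  -- Deleting column j + 1 of K_{n+2} and its first row leaves a matrix whose first column is
  -- (b, 0, …, 0), and whose remaining block is the minor of K_{n+1} at column j.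
  expandAlongTopRow : ∀ n (t : Fin (suc (suc n)) → Series) c → (∀ j → t (suc j) ≈ c) →
    sum (λ j → sign (toℕ j) (t j * determinant (suc n) (minor (Kₛ (suc (suc n))) j)))
      ≈ t zero * D (suc n) + - (c * b) * W (suc n)
  expandAlongTopRow n t c t≈c =
    +-congˡ (trans (sum-cong-≋ {suc n} term)
                   (sym (*-distribˡ-sum (- (c * b)) (laplaceTerm n (onesOnTop (Kₛ (suc n)))))))
    where
    term : ∀ j → sign (toℕ (suc j)) (t (suc j) * determinant (suc n) (minor (Kₛ (suc (suc n))) (suc j)))
               ≈ - (c * b) * sign (toℕ j) (1# * determinant n (minor (Kₛ (suc n)) j))
    term j = begin
      sign (suc k) (t (suc j) * determinant (suc n) (minor (Kₛ (suc (suc n))) (suc j)))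
        ≈⟨ sign-cong (suc k) (*-cong (t≈c j)
             (determinant-expandFirstColumn n (minor (Kₛ (suc (suc n))) (suc j)) (λ _ → refl))) ⟩
      sign (suc k) (c * (b * Y))     ≈⟨ sign-suc k _ ⟩
      - sign k (c * (b * Y))
        ≈⟨ -‿cong (sign-cong k (trans (sym (*-assoc c b Y)) (*-congˡ (sym (*-identityˡ Y))))) ⟩
      - sign k (c * b * (1# * Y))    ≈⟨ -‿cong (sign-*ˡ k (c * b) (1# * Y)) ⟩
      - (c * b * sign k (1# * Y))    ≈⟨ -‿distribˡ-* (c * b) (sign k (1# * Y)) ⟩
      - (c * b) * sign k (1# * Y)    ∎
      where
      k = toℕ j
      Y = determinant n (minor (Kₛ (suc n)) j)

  D-one : D 1 ≈ d + b
  D-one = trans (+-identityʳ _) (*-identityʳ _)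

  W-one : W 1 ≈ 1#
  W-one = trans (+-identityʳ _) (*-identityʳ _)

  D-rec : ∀ n → D (suc (suc n)) ≈ d * D (suc n) + a * b * W (suc n)
  D-rec n = trans (expandAlongTopRow n (Kₛ (suc (suc n)) zero) (- a) (λ _ → refl))
    (+-congˡ (*-congʳ (trans (-‿cong (sym (-‿distribˡ-* a b))) (-‿involutive _))))

  W-rec : ∀ n → W (suc (suc n)) ≈ D (suc n) + - b * W (suc n)
  W-rec n = trans (expandAlongTopRow n (λ _ → 1#) 1# (λ _ → refl))
    (+-cong (*-identityˡ _) (*-congʳ (-‿cong (*-identityˡ b))))

module ClosedForm where

  open BivariateSeries
  open Entries
  open Recurrence
  open SeriesExpansion using (detK-expandsTo)
  open CommutativeRing ℚ⟦x,v⟧ hiding (zero)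
  open import Relation.Binary.Reasoning.Setoid setoid
  open Solver using (solve; _:=_; _:+_; _:*_; :-_; _:-_; con)

  E : ℕ → Series
  E zero    = one
  E (suc k) = e * E k

  -- The base cases are written as sums of products ending in an explicit factor, so that the closure
  -- lemmas for polynomiality, vanishing at x = 0 and the value at v = 1 apply term by term.
  P Y : ℕ → Series
  P zero    = - (a * (e * (d * (d * one) + d * one + one))) + a * (d * (d * one))
              + a * (a * (d * one + d * one))
  P (suc k) = d * (e * P k) + a * (a * Y k) + - (a * E (suc (suc k)))
  Y zero    = d * (d * (e * one)) + a * (a * one)
  Y (suc k) = E (suc (suc k)) + e * P k + - (a * Y k)

  D-two : D 2 ≈ d * (d + b) + a * b * one
  D-two = trans (D-rec 0) (+-cong (*-congˡ D-one) (*-congˡ (trans W-one (sym one≈1#))))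

  W-two : W 2 ≈ d + b + - b * one
  W-two = trans (W-rec 0) (+-cong D-one (*-congˡ (trans W-one (sym one≈1#))))

  D-three : D 3 ≈ d * (d * (d + b) + a * b * one) + a * b * (d + b + - b * one)
  D-three = trans (D-rec 1) (+-cong (*-congˡ D-two) (*-congˡ W-two))

  W-three : W 3 ≈ d * (d + b) + a * b * one + - b * (d + b + - b * one)
  W-three = trans (W-rec 1) (+-cong D-two (*-congˡ W-two))

  D-closedForm-base : D 3 * E 1 ≈ E 1 + P 0
  D-closedForm-base = begin
    D 3 * (e * one)
      ≈⟨ *-congʳ D-three ⟩
    (d * (d * (d + b) + a * b * one) + a * b * (d + b + - b * one)) * (e * one)
      ≈⟨ solve 3 (λ a b e → let d = con 1ℚ :- a ; one = con 1ℚ in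
           (d :* (d :* (d :+ b) :+ a :* b :* one) :+ a :* b :* (d :+ b :+ :- b :* one)) :* (e :* one)
           := d :* d :* d :* e :+ b :* e :* (d :* d :+ a :* d :+ a :* d)) refl a b e ⟩
    d * d * d * e + b * e * (d * d + a * d + a * d)
      ≈⟨ +-congˡ (*-congʳ b*e) ⟩
    d * d * d * e + a * (d * d + a * d + a * d)
      ≈⟨ solve 2 (λ a e → let d = con 1ℚ :- a ; one = con 1ℚ in
           d :* d :* d :* e :+ a :* (d :* d :+ a :* d :+ a :* d)
           := e :* one :+ (:- (a :* (e :* (d :* (d :* one) :+ d :* one :+ one))) :+ a :* (d :* (d :* one))
                           :+ a :* (a :* (d :* one :+ d :* one)))) refl a e ⟩
    E 1 + P 0
      ∎

  W-closedForm-base : W 3 * E 1 ≈ Y 0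
  W-closedForm-base = begin
    W 3 * (e * one)
      ≈⟨ *-congʳ W-three ⟩
    (d * (d + b) + a * b * one + - b * (d + b + - b * one)) * (e * one)
      ≈⟨ solve 3 (λ a b e → let d = con 1ℚ :- a ; one = con 1ℚ in
           (d :* (d :+ b) :+ a :* b :* one :+ :- b :* (d :+ b :+ :- b :* one)) :* (e :* one)
           := d :* d :* e :+ a :* (b :* e)) refl a b e ⟩
    d * d * e + a * (b * e)
      ≈⟨ +-congˡ (*-congˡ b*e) ⟩
    d * d * e + a * a
      ≈⟨ solve 2 (λ a e → let d = con 1ℚ :- a ; one = con 1ℚ in
           d :* d :* e :+ a :* a := d :* (d :* (e :* one)) :+ a :* (a :* one)) refl a e ⟩
    Y 0
      ∎

  module _ (k : ℕ) (D≈ : D (3 ℕ.+ k) * E (suc k) ≈ E (suc k) + P k)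
                   (W≈ : W (3 ℕ.+ k) * E (suc k) ≈ Y k) where

    D-closedForm-step : D (4 ℕ.+ k) * E (2 ℕ.+ k) ≈ E (2 ℕ.+ k) + P (suc k)
    D-closedForm-step = begin
      D (4 ℕ.+ k) * (e * E (suc k))
        ≈⟨ *-congʳ (D-rec (2 ℕ.+ k)) ⟩
      (d * D (3 ℕ.+ k) + a * b * W (3 ℕ.+ k)) * (e * E (suc k))
        ≈⟨ solve 6 (λ a b e D W E → let d = con 1ℚ :- a in
             (d :* D :+ a :* b :* W) :* (e :* E) := d :* e :* (D :* E) :+ a :* (b :* e) :* (W :* E))
             refl a b e (D (3 ℕ.+ k)) (W (3 ℕ.+ k)) (E (suc k)) ⟩
      d * e * (D (3 ℕ.+ k) * E (suc k)) + a * (b * e) * (W (3 ℕ.+ k) * E (suc k))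
        ≈⟨ +-cong (*-congˡ D≈) (*-cong (*-congˡ b*e) W≈) ⟩
      d * e * (E (suc k) + P k) + a * a * Y k
        ≈⟨ solve 5 (λ a e E P Y → let d = con 1ℚ :- a in
             d :* e :* (E :+ P) :+ a :* a :* Y
             := e :* E :+ (d :* (e :* P) :+ a :* (a :* Y) :+ :- (a :* (e :* E)))) refl a e (E (suc k)) (P k) (Y k) ⟩
      E (2 ℕ.+ k) + P (suc k)
        ∎

    W-closedForm-step : W (4 ℕ.+ k) * E (2 ℕ.+ k) ≈ Y (suc k)
    W-closedForm-step = begin
      W (4 ℕ.+ k) * (e * E (suc k))
        ≈⟨ *-congʳ (W-rec (2 ℕ.+ k)) ⟩
      (D (3 ℕ.+ k) + - b * W (3 ℕ.+ k)) * (e * E (suc k))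
        ≈⟨ solve 5 (λ b e D W E → (D :+ :- b :* W) :* (e :* E) := e :* (D :* E) :+ :- (b :* e :* (W :* E)))
             refl b e (D (3 ℕ.+ k)) (W (3 ℕ.+ k)) (E (suc k)) ⟩
      e * (D (3 ℕ.+ k) * E (suc k)) + - (b * e * (W (3 ℕ.+ k) * E (suc k)))
        ≈⟨ +-cong (*-congˡ D≈) (-‿cong (*-cong b*e W≈)) ⟩
      e * (E (suc k) + P k) + - (a * Y k)
        ≈⟨ +-congʳ (distribˡ e (E (suc k)) (P k)) ⟩
      Y (suc k)
        ∎

  closedForm : ∀ k → (D (3 ℕ.+ k) * E (suc k) ≈ E (suc k) + P k) × (W (3 ℕ.+ k) * E (suc k) ≈ Y k)
  closedForm zero    = D-closedForm-base , W-closedForm-base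
  closedForm (suc k) = D-closedForm-step k D≈ W≈ , W-closedForm-step k D≈ W≈
    where
    D≈ = proj₁ (closedForm k)
    W≈ = proj₂ (closedForm k)

  oneMinusV^^≈E : ∀ k → oneMinusV ^^ k ≈ E k
  oneMinusV^^≈E zero    = 𝟙≈one
  oneMinusV^^≈E (suc k) = trans (⊗≋*ₛ oneMinusV (oneMinusV ^^ k)) (*-cong oneMinusV≈e (oneMinusV^^≈E k))

  detK-closedForm : ∀ k →
    det (3 ℕ.+ k) (K (3 ℕ.+ k)) ≈F ((oneMinusV ^^ suc k) ⊕ P k) // (oneMinusV ^^ suc k)
  detK-closedForm k = begin
    numerator ⊗ Eₖ                   ≈⟨ ⊗≋*ₛ numerator Eₖ ⟩
    numerator * Eₖ                   ≈⟨ *-cong (detK-expandsTo (3 ℕ.+ k)) (oneMinusV^^≈E (suc k)) ⟩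
    D (3 ℕ.+ k) * denominator * E (suc k)
      ≈⟨ solve 3 (λ D den E → D :* den :* E := D :* E :* den) refl (D (3 ℕ.+ k)) denominator (E (suc k)) ⟩
    D (3 ℕ.+ k) * E (suc k) * denominator ≈⟨ *-congʳ (proj₁ (closedForm k)) ⟩
    (E (suc k) + P k) * denominator  ≈⟨ *-congʳ (+-congʳ (sym (oneMinusV^^≈E (suc k)))) ⟩
    (Eₖ + P k) * denominator         ≈⟨ *-congʳ (sym (⊕≋+ₛ Eₖ (P k))) ⟩
    (Eₖ ⊕ P k) * denominator         ≈⟨ sym (⊗≋*ₛ (Eₖ ⊕ P k) denominator) ⟩
    (Eₖ ⊕ P k) ⊗ denominator         ∎
    where
    Eₖ = oneMinusV ^^ suc k
    numerator   = num (det (3 ℕ.+ k) (K (3 ℕ.+ k)))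
    denominator = den (det (3 ℕ.+ k) (K (3 ℕ.+ k)))

module Polynomiality where

  open BivariateSeries
  open Entries
  open ClosedForm using (E; P; Y)
  open CommutativeRing ℚ⟦x,v⟧ hiding (zero)
  open ℕₚ using (≤-trans; m≤m⊔n; m≤n⊔m; ≤-pred; +-suc)

  isPoly-resp : ∀ {p q} → p ≈ q → IsPolynomial p → IsPolynomial q
  isPoly-resp p≈q (N , p≡0) = N , λ i j N≤ → ≡.trans (≡.sym (p≈q i j)) (p≡0 i j N≤)

  isPoly-+ : ∀ {p q} → IsPolynomial p → IsPolynomial q → IsPolynomial (p + q)
  isPoly-+ {p} {q} (N₁ , p≡0) (N₂ , q≡0) = N₁ ℕ.⊔ N₂ , λ i j N≤ → ≡.trans (+ₛ-apply p q i j)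
    (≡.cong₂ _+ℚ_ (p≡0 i j (≤-trans (m≤m⊔n N₁ N₂) N≤)) (q≡0 i j (≤-trans (m≤n⊔m N₁ N₂) N≤)))

  isPoly-neg : ∀ {q} → IsPolynomial q → IsPolynomial (- q)
  isPoly-neg {q} (N , q≡0) = N , λ i j N≤ → ≡.trans (-ₛ-apply q i j) (≡.cong -ℚ_ (q≡0 i j N≤))

  isPoly-X* : ∀ {q} → IsPolynomial q → IsPolynomial (X * q)
  isPoly-X* {q} (N , q≡0) = suc N , λ where
    zero    j _         → X*ₛ-zero q j
    (suc i) j (s≤s N≤) → ≡.trans (X*ₛ-suc q i j) (q≡0 i j N≤)

  isPoly-V* : ∀ {q} → IsPolynomial q → IsPolynomial (V * q)
  isPoly-V* {q} (N , q≡0) = suc N , λ where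
    i zero    _  → V*ₛ-zero q i
    i (suc j) N≤ → ≡.trans (V*ₛ-suc q i j) (q≡0 i j (≤-pred (≡.subst (suc N ℕ.≤_) (+-suc i j) N≤)))

  isPoly-constant : ∀ c → IsPolynomial (constant c)
  isPoly-constant c = 1 , λ where
    zero    zero    ()
    zero    (suc j) _ → ≡.refl
    (suc i) j       _ → ≡.refl

  isPoly-a* : ∀ {q} → IsPolynomial q → IsPolynomial (a * q)
  isPoly-a* q-poly = isPoly-resp (sym (a*-expand _)) (isPoly-X* (isPoly-V* q-poly))

  isPoly-e* : ∀ {q} → IsPolynomial q → IsPolynomial (e * q)
  isPoly-e* q-poly = isPoly-resp (sym (e*-expand _)) (isPoly-+ q-poly (isPoly-neg (isPoly-V* q-poly)))

  isPoly-d* : ∀ {q} → IsPolynomial q → IsPolynomial (d * q)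
  isPoly-d* q-poly = isPoly-resp (sym (d*-expand _)) (isPoly-+ q-poly (isPoly-neg (isPoly-X* (isPoly-V* q-poly))))

  isPoly-E : ∀ k → IsPolynomial (E k)
  isPoly-E zero    = isPoly-constant 1ℚ
  isPoly-E (suc k) = isPoly-e* (isPoly-E k)

  isPoly-P×Y : ∀ k → IsPolynomial (P k) × IsPolynomial (Y k)
  isPoly-P×Y zero =
    isPoly-+ (isPoly-+ (isPoly-neg (isPoly-a* (isPoly-e*
                          (isPoly-+ (isPoly-+ (isPoly-d* (isPoly-d* c)) (isPoly-d* c)) c))))
                       (isPoly-a* (isPoly-d* (isPoly-d* c))))
             (isPoly-a* (isPoly-a* (isPoly-+ (isPoly-d* c) (isPoly-d* c)))) ,
    isPoly-+ (isPoly-d* (isPoly-d* (isPoly-e* c))) (isPoly-a* (isPoly-a* c))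
    where c = isPoly-constant 1ℚ
  isPoly-P×Y (suc k) =
    isPoly-+ (isPoly-+ (isPoly-d* (isPoly-e* P-poly)) (isPoly-a* (isPoly-a* Y-poly)))
             (isPoly-neg (isPoly-a* (isPoly-E (suc (suc k))))) ,
    isPoly-+ (isPoly-+ (isPoly-E (suc (suc k))) (isPoly-e* P-poly)) (isPoly-neg (isPoly-a* Y-poly))
    where
    P-poly = proj₁ (isPoly-P×Y k)
    Y-poly = proj₂ (isPoly-P×Y k)

module VanishingAtX0 where

  open BivariateSeries
  open Entries
  open ClosedForm using (P)
  open CommutativeRing ℚ⟦x,v⟧ hiding (zero)

  VanishesAtX0 : Series → Set
  VanishesAtX0 p = ∀ j → p 0 j ≡ 0ℚ

  vanish-resp : ∀ {p q} → p ≈ q → VanishesAtX0 p → VanishesAtX0 q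
  vanish-resp p≈q p≡0 j = ≡.trans (≡.sym (p≈q 0 j)) (p≡0 j)

  vanish-+ : ∀ {p q} → VanishesAtX0 p → VanishesAtX0 q → VanishesAtX0 (p + q)
  vanish-+ {p} {q} p≡0 q≡0 j = ≡.trans (+ₛ-apply p q 0 j) (≡.cong₂ _+ℚ_ (p≡0 j) (q≡0 j))

  vanish-neg : ∀ {q} → VanishesAtX0 q → VanishesAtX0 (- q)
  vanish-neg {q} q≡0 j = ≡.trans (-ₛ-apply q 0 j) (≡.cong -ℚ_ (q≡0 j))

  vanish-V* : ∀ {q} → VanishesAtX0 q → VanishesAtX0 (V * q)
  vanish-V* {q} q≡0 zero    = V*ₛ-zero q 0
  vanish-V* {q} q≡0 (suc j) = ≡.trans (V*ₛ-suc q 0 j) (q≡0 j)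

  vanish-a* : ∀ q → VanishesAtX0 (a * q)
  vanish-a* q = vanish-resp (sym (a*-expand q)) (X*ₛ-zero (V * q))

  vanish-e* : ∀ {q} → VanishesAtX0 q → VanishesAtX0 (e * q)
  vanish-e* q≡0 = vanish-resp (sym (e*-expand _)) (vanish-+ q≡0 (vanish-neg (vanish-V* q≡0)))

  vanish-d* : ∀ {q} → VanishesAtX0 q → VanishesAtX0 (d * q)
  vanish-d* {q} q≡0 = vanish-resp (sym (d*-expand q)) (vanish-+ q≡0 (vanish-neg (X*ₛ-zero (V * q))))

  P-vanishesAtX0 : ∀ k → VanishesAtX0 (P k)
  P-vanishesAtX0 zero    = vanish-+ (vanish-+ (vanish-neg (vanish-a* _)) (vanish-a* _)) (vanish-a* _)
  P-vanishesAtX0 (suc k) = vanish-+ (vanish-+ (vanish-d* (vanish-e* (P-vanishesAtX0 k))) (vanish-a* _))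
                                    (vanish-neg (vanish-a* _))

module EvaluationAtV1 where

  open BivariateSeries
  open Entries
  open ClosedForm using (E; P; Y)
  open Polynomiality using (isPoly-constant; isPoly-+; isPoly-d*; isPoly-E; isPoly-P×Y)
  open CommutativeRing ℚ⟦x,v⟧ hiding (zero)
  open ℕₚ using (≤-trans; m≤m⊔n; m≤n⊔m; m≤n+m)
  open import Algebra.Properties.AbelianGroup ℚₚ.+-0-abelianGroup using (xyx⁻¹≈y)

  -- q(x, 1) = Σᵢ f i xⁱ, i.e. for each i the partial sums of q i over v-degrees are eventually f i.
  ValueAtV1 : Series → (ℕ → ℚ) → Set
  ValueAtV1 q f = ∀ i → ∃ λ K → ∀ N → K ≤ N → ℚ⟦v⟧.sum≤ N (q i) ≡ f i

  shift : (ℕ → ℚ) → ℕ → ℚ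
  shift f zero    = 0ℚ
  shift f (suc i) = f i

  zeros : ℕ → ℚ
  zeros _ = 0ℚ

  atV1-unique : ∀ {q f g} → ValueAtV1 q f → ValueAtV1 q g → ∀ i → f i ≡ g i
  atV1-unique q↦f q↦g i with q↦f i | q↦g i
  ... | K₁ , sum≡f | K₂ , sum≡g =
    ≡.trans (≡.sym (sum≡f (K₁ ℕ.⊔ K₂) (m≤m⊔n K₁ K₂))) (sum≡g (K₁ ℕ.⊔ K₂) (m≤n⊔m K₁ K₂))

  atV1-resp : ∀ {p q f} → p ≈ q → ValueAtV1 p f → ValueAtV1 q f
  atV1-resp p≈q p↦f i with p↦f i
  ... | K , sum≡f = K , λ N K≤N → ≡.trans (ℚ⟦v⟧.sum≤-cong N (λ j → ≡.sym (p≈q i j))) (sum≡f N K≤N)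

  atV1-+ : ∀ {p q f g} → ValueAtV1 p f → ValueAtV1 q g → ValueAtV1 (p + q) (λ i → f i +ℚ g i)
  atV1-+ {p} {q} p↦f q↦g i with p↦f i | q↦g i
  ... | K₁ , sum≡f | K₂ , sum≡g = K₁ ℕ.⊔ K₂ , λ N K≤N →
    ≡.trans (ℚ⟦v⟧.sum≤-cong N (+ₛ-apply p q i)) (≡.trans (ℚ⟦v⟧.sum≤-distrib-+ N _ _)
      (≡.cong₂ _+ℚ_ (sum≡f N (≤-trans (m≤m⊔n K₁ K₂) K≤N)) (sum≡g N (≤-trans (m≤n⊔m K₁ K₂) K≤N))))

  atV1-neg : ∀ {q f} → ValueAtV1 q f → ValueAtV1 (- q) (λ i → -ℚ f i)
  atV1-neg {q} q↦f i with q↦f i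
  ... | K , sum≡f = K , λ N K≤N → ≡.trans (ℚ⟦v⟧.sum≤-cong N (-ₛ-apply q i))
    (≡.trans (≡.sym (ℚ⟦v⟧.-‿distrib-sum≤ N _)) (≡.cong -ℚ_ (sum≡f N K≤N)))

  atV1-X* : ∀ {q f} → ValueAtV1 q f → ValueAtV1 (X * q) (shift f)
  atV1-X* {q} _   zero    = 0 , λ N _ → ℚ⟦v⟧.sum≤-zero N _ (X*ₛ-zero q)
  atV1-X* {q} q↦f (suc i) with q↦f i
  ... | K , sum≡f = K , λ N K≤N → ≡.trans (ℚ⟦v⟧.sum≤-cong N (X*ₛ-suc q i)) (sum≡f N K≤N)

  atV1-V* : ∀ {q f} → ValueAtV1 q f → ValueAtV1 (V * q) f
  atV1-V* {q} q↦f i with q↦f i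
  ... | K , sum≡f = suc K , λ where
    (suc N) (s≤s K≤N) → ≡.trans (ℚ⟦v⟧.sum≤-unfoldˡ N _)
      (≡.trans (≡.cong₂ _+ℚ_ (V*ₛ-zero q i) (ℚ⟦v⟧.sum≤-cong N (V*ₛ-suc q i)))
      (≡.trans (ℚₚ.+-identityˡ _) (sum≡f N K≤N)))

  atV1-one : ValueAtV1 one (λ { zero → 1ℚ ; (suc _) → 0ℚ })
  atV1-one zero    = 0 , λ where
    zero    _ → ≡.refl
    (suc N) _ → ≡.trans (ℚ⟦v⟧.sum≤-unfoldˡ N _)
      (≡.trans (≡.cong (1ℚ +ℚ_) (ℚ⟦v⟧.sum≤-zero N _ (λ _ → ≡.refl))) (ℚₚ.+-identityʳ 1ℚ))
  atV1-one (suc i) = 0 , λ N _ → ℚ⟦v⟧.sum≤-zero N _ (λ _ → ≡.refl)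

  atV1-𝟘 : ValueAtV1 𝟘 zeros
  atV1-𝟘 i = 0 , λ N _ → ℚ⟦v⟧.sum≤-zero N _ (λ _ → ≡.refl)

  atV1-a* : ∀ {q f} → ValueAtV1 q f → ValueAtV1 (a * q) (shift f)
  atV1-a* q↦f = atV1-resp (sym (a*-expand _)) (atV1-X* (atV1-V* q↦f))

  atV1-d* : ∀ {q f} → ValueAtV1 q f → ValueAtV1 (d * q) (λ i → f i +ℚ -ℚ shift f i)
  atV1-d* q↦f = atV1-resp (sym (d*-expand _)) (atV1-+ q↦f (atV1-neg (atV1-X* (atV1-V* q↦f))))

  -- (1 - v) q telescopes along each row, so its partial sums are eventually coefficients of q, i.e. 0.
  atV1-e* : ∀ {q} → IsPolynomial q → ValueAtV1 (e * q) zeros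
  atV1-e* {q} (M , q≡0) = atV1-resp (sym (e*-expand q)) λ i →
    M , λ N M≤N → ≡.trans (telescope i N) (q≡0 i N (≤-trans M≤N (m≤n+m N i)))
    where
    term : ∀ i j → (q + - (V * q)) i j ≡ q i j +ℚ -ℚ (V * q) i j
    term i j = ≡.trans (+ₛ-apply q (- (V * q)) i j) (≡.cong (q i j +ℚ_) (-ₛ-apply (V * q) i j))
    telescope : ∀ i N → ℚ⟦v⟧.sum≤ N ((q + - (V * q)) i) ≡ q i N
    telescope i zero    = ≡.trans (term i 0)
      (≡.trans (≡.cong (λ z → q i 0 +ℚ -ℚ z) (V*ₛ-zero q i)) (ℚₚ.+-identityʳ _))
    telescope i (suc N) = ≡.trans (≡.cong₂ _+ℚ_ (telescope i N)
      (≡.trans (term i (suc N)) (≡.cong (λ z → q i (suc N) +ℚ -ℚ z) (V*ₛ-suc q i N))))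
      (≡.trans (≡.sym (ℚₚ.+-assoc (q i N) _ _)) (xyx⁻¹≈y (q i N) (q i (suc N))))

  IsSign : ℚ → Set
  IsSign s = s ≡ 1ℚ ⊎ s ≡ -ℚ 1ℚ

  IsSign-neg : ∀ {s} → IsSign s → IsSign (-ℚ s)
  IsSign-neg (inj₁ s≡1)  = inj₂ (≡.cong -ℚ_ s≡1)
  IsSign-neg (inj₂ s≡-1) = inj₁ (≡.cong -ℚ_ s≡-1)

  IsSign⇒≢0 : ∀ {s} → IsSign s → s ≢ 0ℚ
  IsSign⇒≢0 (inj₁ ≡.refl) ()
  IsSign⇒≢0 (inj₂ ≡.refl) ()

  Y-atV1 : ∀ k → ∃ λ f → ValueAtV1 (Y k) f × IsSign (f (2 ℕ.+ k))
  Y-atV1 zero    = _ ,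
    atV1-+ (atV1-d* (atV1-d* (atV1-e* (isPoly-constant 1ℚ)))) (atV1-a* (atV1-a* atV1-one)) ,
    inj₁ ≡.refl
  Y-atV1 (suc k) with Y-atV1 k
  ... | f , Y↦f , f-sign = _ ,
    atV1-+ (atV1-+ (atV1-e* (isPoly-E (suc k))) (atV1-e* (proj₁ (isPoly-P×Y k)))) (atV1-neg (atV1-a* Y↦f)) ,
    ≡.subst IsSign (≡.sym (ℚₚ.+-identityˡ _)) (IsSign-neg f-sign)

  P-atV1 : ∀ k → ∃ λ f → ValueAtV1 (P k) f × IsSign (f (3 ℕ.+ k))
  P-atV1 zero    = _ ,
    atV1-+ (atV1-+ (atV1-neg (atV1-a* (atV1-e* (isPoly-+ (isPoly-+ (isPoly-d* (isPoly-d* c)) (isPoly-d* c)) c))))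
                   (atV1-a* (atV1-d* (atV1-d* atV1-one))))
           (atV1-a* (atV1-a* (atV1-+ (atV1-d* atV1-one) (atV1-d* atV1-one)))) ,
    inj₂ ≡.refl
    where
    c = isPoly-constant 1ℚ
  P-atV1 (suc k) with Y-atV1 k
  ... | f , Y↦f , f-sign = _ ,
    atV1-+ (atV1-+ (atV1-d* (atV1-e* (proj₁ (isPoly-P×Y k)))) (atV1-a* (atV1-a* Y↦f)))
           (atV1-neg (atV1-a* (atV1-e* (isPoly-E (suc k))))) ,
    ≡.subst IsSign (≡.sym (≡.trans (ℚₚ.+-identityʳ _) (ℚₚ.+-identityˡ _))) f-sign

  P≉𝟘 : ∀ k → ¬ (P k ≋ 𝟘)
  P≉𝟘 k P≋𝟘 with P-atV1 k
  ... | _ , P↦f , f-sign = IsSign⇒≢0 f-sign (atV1-unique P↦f (atV1-resp (sym P≋𝟘) atV1-𝟘) (3 ℕ.+ k))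

  oneMinusV∤P : ∀ k → ¬ (oneMinusV ∣ₚ P k)
  oneMinusV∤P k (Q , Q-poly , P≋Q-oneMinusV) with P-atV1 k
  ... | _ , P↦f , f-sign =
    IsSign⇒≢0 f-sign (atV1-unique P↦f (atV1-resp (sym P≈eQ) (atV1-e* Q-poly)) (3 ℕ.+ k))
    where
    P≈eQ : P k ≈ e * Q
    P≈eQ = trans P≋Q-oneMinusV (trans (⊗≋*ₛ oneMinusV Q) (*-congʳ oneMinusV≈e))

theorem15 : (m : ℕ) → 3 ≤ m →
    Σ Series (λ P →
      IsPolynomial P
      × ¬ (P ≋ 𝟘)
      × (∀ j → P 0 j ≡ 0ℚ)
      × ¬ (oneMinusV ∣ₚ P)
      × (det m (K m) ≈F ((oneMinusV ^^ (m ∸ 2)) ⊕ P) // (oneMinusV ^^ (m ∸ 2))))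
theorem15 (suc (suc (suc k))) (s≤s (s≤s (s≤s _))) =
  P k , proj₁ (isPoly-P×Y k) , P≉𝟘 k , P-vanishesAtX0 k , oneMinusV∤P k , detK-closedForm k
  where
  open ClosedForm using (P; detK-closedForm)
  open Polynomiality using (isPoly-P×Y)
  open VanishingAtX0 using (P-vanishesAtX0)
  open EvaluationAtV1 using (P≉𝟘; oneMinusV∤P)
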